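{- Let $t,p$ be positive integers with $N:=\lfloor\frac{t+p-2}{p}\rfloor\geq 1$, and for $1\leq k\leq N$ let $S_k=\{x\in\mathbb{Z}:(k-1)(t+p)+1\leq x\leq kt-1\}$ and $a_k=\#S_k$. Then $a_k=t-(k-1)p-1$ for $1\leq k\leq N$; consequently $1\leq a_N\leq p$ and $a_k-a_{k+1}=p$ for $1\leq k\leq N-1$. Moreover, for $1\leq k\leq N-1$, every $x\in S_{k+1}$ and every $0\leq i\leq p$, we have $x-(t+i)\in S_k$. Furthermore, $\bigcup_{1\leq k\leq N}S_k$ is the $\beta$-set of some $(t,t+1,\ldots,t+p)$-core partition.
   Context: A partition $\lambda=(\lambda_1,\ldots,\lambda_r)$ is a finite weakly decreasing sequence of positive integers. In its Young diagram, the hook length $h(i,j)$ of box $(i,j)$ is the number of boxes directly to its right, directly below it, plus the box itself. $\lambda$ is a $t$-core partition if no hook length is divisible by $t$, and a $(t_1,\ldots,t_m)$-core partition if it is a $t_i$-core for all $i$. The $\beta$-set of $\lambda$ is $\beta(\lambda)=\{h(i,1):1\leq i\leq r\}$; every finite set of positive integers is the $\beta$-set of a unique partition. $\#A$ denotes the cardinality of a set $A$. -}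

module Defs where

open import Data.Nat using (ℕ; zero; suc; _+_; _*_; _∸_; _≤_; _<_; _≥_; _≤?_; NonZero)
open import Data.Nat.DivMod using (_/_)
open import Data.Nat.Divisibility using (_∣_)
open import Data.List using (List; []; _∷_; length; filter; upTo)
open import Data.List.Relation.Unary.All using (All)
open import Data.List.Relation.Unary.Linked using (Linked)
open import Data.Product using (_×_; ∃-syntax)
open import Relation.Binary.PropositionalEquality using (_≡_)
open import Relation.Nullary using (Dec; ¬_)
open import Relation.Nullary.Decidable using (_×-dec_)

N : (t p : ℕ) → .{{_ : NonZero p}} → ℕ
N t p = (t + p ∸ 2) / p

-- x ∈ S_k  iff  (k-1)(t+p)+1 ≤ x ≤ kt-1.
-- For k ≥ 1 and t ≥ 1 all such integers are positive, so S_k ⊆ ℕ and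
-- kt ∸ 1 = kt - 1.
S : (t p k x : ℕ) → Set
S t p k x = (k ∸ 1) * (t + p) + 1 ≤ x × x ≤ k * t ∸ 1

S? : (t p k x : ℕ) → Dec (S t p k x)
S? t p k x = ((k ∸ 1) * (t + p) + 1 ≤? x) ×-dec (x ≤? k * t ∸ 1)

-- a_k = #S_k : every element of S_k is < k*t, so S_k is the list of
-- x ∈ {0,…,kt-1} satisfying S, and #S_k is its length.
a : (t p k : ℕ) → ℕ
a t p k = length (filter (S? t p k) (upTo (k * t)))

IsPartition : List ℕ → Set
IsPartition λs = All (λ m → 0 < m) λs × Linked _≥_ λs

-- λ_i, 1-indexed (0 outside 1..r)
part : List ℕ → ℕ → ℕ
part []       _             = 0
part (m ∷ ms) zero          = 0
part (m ∷ ms) (suc zero)    = m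
part (m ∷ ms) (suc (suc i)) = part ms (suc i)

conj : List ℕ → ℕ → ℕ
conj λs j = length (filter (j ≤?_) λs)

Box : List ℕ → ℕ → ℕ → Set
Box λs i j = 1 ≤ i × i ≤ length λs × 1 ≤ j × j ≤ part λs i

hook : List ℕ → ℕ → ℕ → ℕ
hook λs i j = (part λs i ∸ j) + (conj λs j ∸ i) + 1

IsCore : ℕ → List ℕ → Set
IsCore t λs = ∀ i j → Box λs i j → ¬ (t ∣ hook λs i j)

IsMultiCore : ℕ → ℕ → List ℕ → Set
IsMultiCore t p λs = ∀ s → t ≤ s → s ≤ t + p → IsCore s λs

InBeta : List ℕ → ℕ → Set
InBeta λs x = ∃[ i ] (1 ≤ i × i ≤ length λs × hook λs i 1 ≡ x)

module Submission where

-- The counting statements are elementary: S_{k+1} is the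
-- integer interval [k(t+p)+1, (k+1)t-1], so a_{k+1} = t ∸ kp ∸ 1, and the
-- definition of N = ⌊(t+p-2)/p⌋ amounts to the two inequalities
-- kp + 2 ≤ t for k < N and t ≤ Np + 1.  The shift property is arithmetic.
--
-- For the core partition we stack rectangular blocks: block k (1 ≤ k ≤ N)
-- consists of a_k rows of length c_k, where c_0 = 0 and c_{k+1} = c_k + kp + 1,
-- with block N on top.  Since c_k + (a_1 + … + a_k) = kt, the hook of a box
-- in the top rows of block k, lying in the columns (c_m, c_{m+1}], satisfies
-- h + i + j + (a_1 + … + a_m) = kt + 1, which forces h ∈ S_{k-m}.  No element
-- of any S_e is divisible by an s ∈ [t, t+p], so the partition is a
-- (t, …, t+p)-core; in the first column (m = 0) the hooks of block k are
-- exactly S_k, which identifies the β-set.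

open import Defs
open import Data.Nat using (ℕ; zero; suc; _+_; _*_; _∸_; _≤_; _<_; _≥_; z≤n; s≤s; _≤?_; NonZero; >-nonZero⁻¹)
open import Data.Nat.Properties
open import Data.Nat.DivMod using (_%_; m/n*n≤m; m≡m%n+[m/n]*n; m%n<n)
open import Data.Nat.Divisibility using (_∣_; divides)
open import Data.Nat.Tactic.RingSolver using (solve-∀)
open import Data.List using (List; []; _∷_; length; filter; upTo; replicate; _++_)
open import Data.List.Properties using (upTo-∷ʳ; filter-++; length-++; length-replicate; filter-accept; filter-reject; filter-all; filter-none)
open import Data.List.Relation.Unary.All as All using (All; []; _∷_)
open import Data.List.Relation.Unary.All.Properties using (replicate⁺; ++⁺)
open import Data.List.Relation.Unary.Linked using (Linked; []; [-]; _∷_)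
open import Data.Product using (_×_; _,_; proj₁; ∃-syntax)
open import Data.Sum using (_⊎_; inj₁; inj₂)
open import Data.Sum.Function.Propositional using (_⊎-⇔_)
open import Data.Empty using (⊥-elim)
open import Function.Bundles using (_⇔_; mk⇔)
import Function.Properties.Equivalence as ⇔
open import Relation.Binary.PropositionalEquality
open import Relation.Nullary using (yes; no; ¬_)
open import Relation.Nullary.Decidable using (_×-dec_)
open import Relation.Unary using (Pred; Decidable)

count-upTo-suc : ∀ {ℓ} {P : Pred ℕ ℓ} (P? : Decidable P) n →
  length (filter P? (upTo (suc n))) ≡ length (filter P? (upTo n)) + length (filter P? (n ∷ []))
count-upTo-suc P? n = begin
    length (filter P? (upTo (suc n)))
  ≡⟨ cong (λ l → length (filter P? l)) (sym (upTo-∷ʳ n)) ⟩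
    length (filter P? (upTo n ++ n ∷ []))
  ≡⟨ cong length (filter-++ P? (upTo n) (n ∷ [])) ⟩
    length (filter P? (upTo n) ++ filter P? (n ∷ []))
  ≡⟨ length-++ (filter P? (upTo n)) ⟩
    length (filter P? (upTo n)) + length (filter P? (n ∷ []))
  ∎ where open ≡-Reasoning

count-interval : ∀ lo hi n → n ≤ suc hi →
  length (filter (λ x → (lo ≤? x) ×-dec (x ≤? hi)) (upTo n)) ≡ n ∸ lo
count-interval lo hi zero    _          = sym (0∸n≡0 lo)
count-interval lo hi (suc n) 1+n≤1+hi = begin
    length (filter P? (upTo (suc n)))
  ≡⟨ count-upTo-suc P? n ⟩
    length (filter P? (upTo n)) + length (filter P? (n ∷ []))
  ≡⟨ cong (_+ length (filter P? (n ∷ []))) (count-interval lo hi n (m≤n⇒m≤1+n n≤hi)) ⟩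
    n ∸ lo + length (filter P? (n ∷ []))
  ≡⟨ count-last ⟩
    suc n ∸ lo
  ∎
  where
  open ≡-Reasoning
  P? = λ x → (lo ≤? x) ×-dec (x ≤? hi)
  n≤hi : n ≤ hi
  n≤hi = ≤-pred 1+n≤1+hi
  count-last : n ∸ lo + length (filter P? (n ∷ [])) ≡ suc n ∸ lo
  count-last with lo ≤? n
  ... | yes lo≤n = begin
      n ∸ lo + length (filter P? (n ∷ []))
        ≡⟨ cong (λ l → n ∸ lo + length l) (filter-accept P? (lo≤n , n≤hi)) ⟩
      n ∸ lo + 1                             ≡⟨ +-comm (n ∸ lo) 1 ⟩
      suc (n ∸ lo)                           ≡⟨ +-∸-assoc 1 lo≤n ⟨
      suc n ∸ lo                             ∎
  ... | no lo≰n = begin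
      n ∸ lo + length (filter P? (n ∷ []))
        ≡⟨ cong (λ l → n ∸ lo + length l) (filter-reject P? (λ in-range → lo≰n (proj₁ in-range))) ⟩
      n ∸ lo + 0                             ≡⟨ +-identityʳ (n ∸ lo) ⟩
      n ∸ lo                                 ≡⟨ m≤n⇒m∸n≡0 (≤-trans (n≤1+n n) (≰⇒> lo≰n)) ⟩
      0                                      ≡⟨ m≤n⇒m∸n≡0 (≰⇒> lo≰n) ⟨
      suc n ∸ lo                             ∎

a-closed : ∀ t p k → a t p (suc k) ≡ t ∸ k * p ∸ 1
a-closed t p k = begin
    a t p (suc k)
  ≡⟨ count-interval (k * (t + p) + 1) (suc k * t ∸ 1) (suc k * t) (m≤n+m∸n (suc k * t) 1) ⟩
    (t + k * t) ∸ (k * (t + p) + 1)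
  ≡⟨ cong (λ z → (t + k * t) ∸ (z + 1)) (*-distribˡ-+ k t p) ⟩
    (t + k * t) ∸ (k * t + k * p + 1)
  ≡⟨ cong₂ _∸_ (+-comm t (k * t)) (+-assoc (k * t) (k * p) 1) ⟩
    (k * t + t) ∸ (k * t + (k * p + 1))
  ≡⟨ [m+n]∸[m+o]≡n∸o (k * t) t (k * p + 1) ⟩
    t ∸ (k * p + 1)
  ≡⟨ sym (∸-+-assoc t (k * p) 1) ⟩
    t ∸ k * p ∸ 1
  ∎ where open ≡-Reasoning

a-pos : ∀ t p k → k * p + 2 ≤ t → 1 ≤ a t p (suc k)
a-pos t p k room = subst (1 ≤_) (sym (trans (a-closed t p k) (∸-+-assoc t (k * p) 1)))
  (m+n≤o⇒m≤o∸n 1 (subst (_≤ t) (regroup (k * p)) room))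
  where
  regroup : ∀ x → x + 2 ≡ 1 + (x + 1)
  regroup = solve-∀

a-le : ∀ t p k → t ≤ suc k * p + 1 → a t p (suc k) ≤ p
a-le t p k t≤ = subst (_≤ p) (sym (trans (a-closed t p k) (∸-+-assoc t (k * p) 1)))
  (m≤n+o⇒m∸n≤o t (k * p + 1) (subst (t ≤_) (regroup k p) t≤))
  where
  regroup : ∀ k p → suc k * p + 1 ≡ k * p + 1 + p
  regroup = solve-∀

a-top : ∀ t p n → 1 ≤ n → (∀ k → k < n → k * p + 2 ≤ t) → t ≤ n * p + 1 → 1 ≤ a t p n × a t p n ≤ p
a-top t p (suc n) _ room t≤ = a-pos t p n (room n ≤-refl) , a-le t p n t≤

a-step : ∀ t p k → suc k * p + 1 ≤ t → a t p (suc k) ≡ a t p (suc k + 1) + p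
a-step t p k room = begin
    a t p (suc k)
  ≡⟨ a-closed t p k ⟩
    t ∸ k * p ∸ 1
  ≡⟨ ∸-+-assoc t (k * p) 1 ⟩
    t ∸ (k * p + 1)
  ≡⟨ cong (_∸ (k * p + 1)) t≡ ⟨
    r + p + (k * p + 1) ∸ (k * p + 1)
  ≡⟨ m+n∸n≡m (r + p) (k * p + 1) ⟩
    r + p
  ≡⟨ cong (_+ p) (trans (sym (∸-+-assoc t ((k + 1) * p) 1)) (sym (a-closed t p (k + 1)))) ⟩
    a t p (suc k + 1) + p
  ∎
  where
  open ≡-Reasoning
  c = (k + 1) * p + 1
  r = t ∸ c
  regroup₁ : ∀ k p → suc k * p + 1 ≡ (k + 1) * p + 1
  regroup₁ = solve-∀
  regroup₂ : ∀ r k p → r + p + (k * p + 1) ≡ r + ((k + 1) * p + 1)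
  regroup₂ = solve-∀
  t≡ : r + p + (k * p + 1) ≡ t
  t≡ = trans (regroup₂ r k p) (trans (+-comm r c) (m+[n∸m]≡n (subst (_≤ t) (regroup₁ k p) room)))

N-room : ∀ t p .{{_ : NonZero p}} → 1 ≤ t → ∀ k → k < N t p → k * p + 2 ≤ t
N-room t p 1≤t k k<N = +-cancelˡ-≤ p _ _ (begin
    p + (k * p + 2)   ≡⟨ +-assoc p (k * p) 2 ⟨
    suc k * p + 2     ≤⟨ +-monoˡ-≤ 2 (≤-trans (*-monoˡ-≤ p k<N) (m/n*n≤m (t + p ∸ 2) p)) ⟩
    t + p ∸ 2 + 2     ≡⟨ m∸n+n≡m (+-mono-≤ 1≤t (>-nonZero⁻¹ p)) ⟩
    t + p             ≡⟨ +-comm t p ⟩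
    p + t             ∎)
  where open ≤-Reasoning

N-max : ∀ t p .{{_ : NonZero p}} → 1 ≤ t → t ≤ N t p * p + 1
N-max t p 1≤t = +-cancelˡ-≤ p _ _ (begin
    p + t                        ≡⟨ +-comm p t ⟩
    t + p                        ≡⟨ m∸n+n≡m (+-mono-≤ 1≤t (>-nonZero⁻¹ p)) ⟨
    m + 2                        ≡⟨ cong (_+ 2) (m≡m%n+[m/n]*n m p) ⟩
    m % p + N t p * p + 2        ≡⟨ regroup (m % p) (N t p * p) ⟩
    suc (m % p) + (N t p * p + 1) ≤⟨ +-monoˡ-≤ (N t p * p + 1) (m%n<n m p) ⟩
    p + (N t p * p + 1)          ∎)
  where
  open ≤-Reasoning
  m = t + p ∸ 2
  regroup : ∀ r q → r + q + 2 ≡ suc r + (q + 1)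
  regroup = solve-∀

<⇒≤∸1 : ∀ {x T} → x < T → x ≤ T ∸ 1
<⇒≤∸1 {T = suc T} (s≤s x≤T) = x≤T

≤∸1⇒< : ∀ {x T} → 1 ≤ x → x ≤ T ∸ 1 → x < T
≤∸1⇒< {T = zero}  1≤x x≤0 = ⊥-elim (<⇒≱ 1≤x x≤0)
≤∸1⇒< {T = suc T} _   x≤T = s≤s x≤T

S-shift : ∀ t p k x i → 1 ≤ k → S t p (k + 1) x → i ≤ p → t + i ≤ x × S t p k (x ∸ (t + i))
S-shift t p (suc k) x i _ (lo , hi) i≤p = t+i≤x , lower , upper
  where
  open ≤-Reasoning
  w = t + p
  next-window : ∀ k w → (k + 1) * w + 1 ≡ k * w + 1 + w
  next-window = solve-∀
  next-top : ∀ k t → (suc k + 1) * t ≡ suc k * t + t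
  next-top = solve-∀
  lo+t+i≤x : k * w + 1 + (t + i) ≤ x
  lo+t+i≤x = begin
    k * w + 1 + (t + i)   ≤⟨ +-monoʳ-≤ (k * w + 1) (+-monoʳ-≤ t i≤p) ⟩
    k * w + 1 + w         ≡⟨ next-window k w ⟨
    (suc k + 1 ∸ 1) * w + 1 ≤⟨ lo ⟩
    x                     ∎
  t+i≤x : t + i ≤ x
  t+i≤x = ≤-trans (m≤n+m (t + i) (k * w + 1)) lo+t+i≤x
  lower : k * w + 1 ≤ x ∸ (t + i)
  lower = m+n≤o⇒m≤o∸n (k * w + 1) lo+t+i≤x
  upper : x ∸ (t + i) ≤ suc k * t ∸ 1
  upper = begin
      x ∸ (t + i)                 ≤⟨ ∸-monoʳ-≤ x (m≤m+n t i) ⟩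
      x ∸ t                       ≤⟨ ∸-monoˡ-≤ t hi ⟩
      (suc k + 1) * t ∸ 1 ∸ t     ≡⟨ ∸-+-assoc ((suc k + 1) * t) 1 t ⟩
      (suc k + 1) * t ∸ (1 + t)   ≡⟨ cong₂ _∸_ (next-top k t) (+-comm 1 t) ⟩
      (suc k * t + t) ∸ (t + 1)   ≡⟨ ∸-+-assoc (suc k * t + t) t 1 ⟨
      suc k * t + t ∸ t ∸ 1       ≡⟨ cong (_∸ 1) (m+n∸n≡m (suc k * t) t) ⟩
      suc k * t ∸ 1               ∎

-- No s ∈ [t, t+p] divides an element x of S_{e+1}: the multiples qs with
-- q ≤ e are ≤ e(t+p) < x, those with q > e are ≥ (e+1)t > x.
S-no-divisor : ∀ t p e x s → S t p (suc e) x → t ≤ s → s ≤ t + p → ¬ (s ∣ x)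
S-no-divisor t p e x s (lo , hi) t≤s s≤t+p (divides q x≡qs) with q ≤? e
... | yes q≤e = <⇒≱ (subst (_≤ x) (+-comm (e * (t + p)) 1) lo)
                    (subst (_≤ e * (t + p)) (sym x≡qs) (*-mono-≤ q≤e s≤t+p))
... | no q≰e  = <⇒≱ (≤∸1⇒< (≤-trans (m≤n+m 1 _) lo) hi)
                    (subst (suc e * t ≤_) (sym x≡qs) (*-mono-≤ (≰⇒> q≰e) t≤s))

S-offsets : ∀ t p k h x → suc k * t ≡ h + (k * (t + p) + 1) →
  S t p (suc k) x ⇔ (∃[ i ] (1 ≤ i × i ≤ h × x + i ≡ suc k * t))
S-offsets t p k h x T≡ = mk⇔ to from
  where
  T = suc k * t
  lo = k * (t + p) + 1
  to : S t p (suc k) x → ∃[ i ] (1 ≤ i × i ≤ h × x + i ≡ T)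
  to (lo≤x , x≤T∸1) = T ∸ x , m+n≤o⇒m≤o∸n 1 x<T , m≤n+o⇒m∸n≤o T x T≤x+h , m+[n∸m]≡n (<⇒≤ x<T)
    where
    open ≤-Reasoning
    x<T : x < T
    x<T = ≤∸1⇒< (≤-trans (m≤n+m 1 _) lo≤x) x≤T∸1
    T≤x+h : T ≤ x + h
    T≤x+h = begin
      T       ≡⟨ T≡ ⟩
      h + lo  ≤⟨ +-monoʳ-≤ h lo≤x ⟩
      h + x   ≡⟨ +-comm h x ⟩
      x + h   ∎
  from : ∃[ i ] (1 ≤ i × i ≤ h × x + i ≡ T) → S t p (suc k) x
  from (i , 1≤i , i≤h , x+i≡T) = +-cancelʳ-≤ i lo x lo+i≤x+i , <⇒≤∸1 x<T
    where
    open ≤-Reasoning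
    lo+i≤x+i : lo + i ≤ x + i
    lo+i≤x+i = begin
      lo + i  ≤⟨ +-monoʳ-≤ lo i≤h ⟩
      lo + h  ≡⟨ +-comm lo h ⟩
      h + lo  ≡⟨ T≡ ⟨
      T       ≡⟨ x+i≡T ⟨
      x + i   ∎
    x<T : x < T
    x<T = begin-strict
      x       <⟨ m<m+n x 1≤i ⟩
      x + i   ≡⟨ x+i≡T ⟩
      T       ∎

stack : ℕ → ℕ → List ℕ → List ℕ
stack n v L = replicate n v ++ L

length-stack : ∀ n v L → length (stack n v L) ≡ n + length L
length-stack n v L = trans (length-++ (replicate n v)) (cong (_+ length L) (length-replicate n))

part-stack-top : ∀ n v L i → 1 ≤ i → i ≤ n → part (stack n v L) i ≡ v
part-stack-top (suc n) v L 1               _ _          = refl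
part-stack-top (suc n) v L (suc (suc i)) _ (s≤s i<n) = part-stack-top n v L (suc i) (s≤s z≤n) i<n

part-stack-below : ∀ n v L i → part (stack n v L) (n + suc i) ≡ part L (suc i)
part-stack-below zero    v L i = refl
part-stack-below (suc n) v L i = begin
    part (stack (suc n) v L) (suc (n + suc i))
  ≡⟨ cong (λ r → part (stack (suc n) v L) (suc r)) (+-suc n i) ⟩
    part (stack n v L) (suc (n + i))
  ≡⟨ cong (part (stack n v L)) (+-suc n i) ⟨
    part (stack n v L) (n + suc i)
  ≡⟨ part-stack-below n v L i ⟩
    part L (suc i)
  ∎ where open ≡-Reasoning

part-bounded : ∀ {v} L i → All (_≤ v) L → part L i ≤ v
part-bounded []       i             _           = z≤n
part-bounded (m ∷ ms) zero          _           = z≤n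
part-bounded (m ∷ ms) 1             (m≤v ∷ _)   = m≤v
part-bounded (m ∷ ms) (suc (suc i)) (_ ∷ ms≤v) = part-bounded ms (suc i) ms≤v

conj-stack : ∀ n v L j → j ≤ v → conj (stack n v L) j ≡ n + conj L j
conj-stack n v L j j≤v = begin
    length (filter (j ≤?_) (replicate n v ++ L))
  ≡⟨ cong length (filter-++ (j ≤?_) (replicate n v) L) ⟩
    length (filter (j ≤?_) (replicate n v) ++ filter (j ≤?_) L)
  ≡⟨ length-++ (filter (j ≤?_) (replicate n v)) ⟩
    length (filter (j ≤?_) (replicate n v)) + conj L j
  ≡⟨ cong (λ l → length l + conj L j) (filter-all (j ≤?_) (replicate⁺ n j≤v)) ⟩
    length (replicate n v) + conj L j
  ≡⟨ cong (_+ conj L j) (length-replicate n) ⟩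
    n + conj L j
  ∎ where open ≡-Reasoning

conj-beyond : ∀ L j → All (_< j) L → conj L j ≡ 0
conj-beyond L j L<j = cong length (filter-none (j ≤?_) (All.map <⇒≱ L<j))

hook-stack-below : ∀ n v L i j → j ≤ v → hook (stack n v L) (n + suc i) j ≡ hook L (suc i) j
hook-stack-below n v L i j j≤v = begin
    (part (stack n v L) (n + suc i) ∸ j) + (conj (stack n v L) j ∸ (n + suc i)) + 1
  ≡⟨ cong₂ (λ r c → (r ∸ j) + (c ∸ (n + suc i)) + 1) (part-stack-below n v L i) (conj-stack n v L j j≤v) ⟩
    (part L (suc i) ∸ j) + ((n + conj L j) ∸ (n + suc i)) + 1
  ≡⟨ cong (λ c → (part L (suc i) ∸ j) + c + 1) ([m+n]∸[m+o]≡n∸o n (conj L j) (suc i)) ⟩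
    hook L (suc i) j
  ∎ where open ≡-Reasoning

hook-stack-top : ∀ n v L i j → 1 ≤ i → i ≤ n → j ≤ v →
  hook (stack n v L) i j + i + j ≡ v + (n + conj L j) + 1
hook-stack-top n v L i j 1≤i i≤n j≤v = begin
    (part (stack n v L) i ∸ j) + (conj (stack n v L) j ∸ i) + 1 + i + j
  ≡⟨ cong₂ (λ r c → (r ∸ j) + (c ∸ i) + 1 + i + j) (part-stack-top n v L i 1≤i i≤n) (conj-stack n v L j j≤v) ⟩
    (v ∸ j) + (n + C ∸ i) + 1 + i + j
  ≡⟨ regroup (v ∸ j) (n + C ∸ i) i j ⟩
    ((v ∸ j) + j) + ((n + C ∸ i) + i) + 1
  ≡⟨ cong₂ (λ r c → r + c + 1) (m∸n+n≡m j≤v) (m∸n+n≡m (≤-trans i≤n (m≤m+n n C))) ⟩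
    v + (n + C) + 1
  ∎ where
    open ≡-Reasoning
    C = conj L j
    regroup : ∀ r c i j → r + c + 1 + i + j ≡ (r + j) + (c + i) + 1
    regroup = solve-∀

row-split : ∀ n v L i → i ≤ length (stack n v L) →
  i ≤ n ⊎ ∃[ o ] (i ≡ n + suc o × suc o ≤ length L)
row-split n v L i i≤len with i ≤? n
... | yes i≤n = inj₁ i≤n
... | no i≰n with m≤n⇒∃[o]m+o≡n (≰⇒> i≰n)
...   | o , n+1+o≡i = inj₂ (o , i≡ , +-cancelˡ-≤ n _ _ n+1+o≤n+len)
  where
  i≡ : i ≡ n + suc o
  i≡ = trans (sym n+1+o≡i) (sym (+-suc n o))
  n+1+o≤n+len : n + suc o ≤ n + length L
  n+1+o≤n+len = subst₂ _≤_ i≡ (length-stack n v L) i≤len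

box-split : ∀ n v L i j → All (_≤ v) L → Box (stack n v L) i j →
  (i ≤ n × j ≤ v) ⊎ ∃[ o ] (Box L (suc o) j × hook (stack n v L) i j ≡ hook L (suc o) j)
box-split n v L i j L≤v (1≤i , i≤len , 1≤j , j≤row) with row-split n v L i i≤len
... | inj₁ i≤n = inj₁ (i≤n , subst (j ≤_) (part-stack-top n v L i 1≤i i≤n) j≤row)
... | inj₂ (o , refl , o<len) =
  inj₂ (o , (s≤s z≤n , o<len , 1≤j , j≤row′) ,
        hook-stack-below n v L o j (≤-trans j≤row′ (part-bounded L (suc o) L≤v)))
  where
  j≤row′ : j ≤ part L (suc o)
  j≤row′ = subst (j ≤_) (part-stack-below n v L o) j≤row

beta-stack : ∀ n v L x → 1 ≤ v → All (_≤ v) L →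
  InBeta (stack n v L) x ⇔ (∃[ i ] (1 ≤ i × i ≤ n × hook (stack n v L) i 1 ≡ x) ⊎ InBeta L x)
beta-stack n v L x 1≤v L≤v = mk⇔ to from
  where
  to : InBeta (stack n v L) x → ∃[ i ] (1 ≤ i × i ≤ n × hook (stack n v L) i 1 ≡ x) ⊎ InBeta L x
  to (i , 1≤i , i≤len , h≡x) with row-split n v L i i≤len
  ... | inj₁ i≤n = inj₁ (i , 1≤i , i≤n , h≡x)
  ... | inj₂ (o , refl , o<len) = inj₂ (suc o , s≤s z≤n , o<len , trans (sym (hook-stack-below n v L o 1 1≤v)) h≡x)
  from : ∃[ i ] (1 ≤ i × i ≤ n × hook (stack n v L) i 1 ≡ x) ⊎ InBeta L x → InBeta (stack n v L) x
  from (inj₁ (i , 1≤i , i≤n , h≡x)) =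
    i , 1≤i , subst (i ≤_) (sym (length-stack n v L)) (≤-trans i≤n (m≤m+n n (length L))) , h≡x
  from (inj₂ (zero , () , _))
  from (inj₂ (suc o , _ , o<len , h≡x)) =
    n + suc o , ≤-trans (s≤s z≤n) (m≤n+m (suc o) n) ,
    subst (n + suc o ≤_) (sym (length-stack n v L)) (+-monoʳ-≤ n o<len) ,
    trans (hook-stack-below n v L o 1 1≤v) h≡x

stack-partition : ∀ n v L → 1 ≤ v → All (_≤ v) L → IsPartition L → IsPartition (stack n v L)
stack-partition n v L 1≤v L≤v (L>0 , L-dec) = ++⁺ (replicate⁺ n 1≤v) L>0 , decreasing n
  where
  longest : ∀ {xs} → All (_≤ v) xs → Linked _≥_ xs → Linked _≥_ (v ∷ xs)
  longest []          _      = [-]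
  longest (x≤v ∷ _)   xs-dec = x≤v ∷ xs-dec
  decreasing : ∀ n → Linked _≥_ (stack n v L)
  decreasing zero    = L-dec
  decreasing (suc n) = longest (++⁺ (replicate⁺ n ≤-refl) L≤v) (decreasing n)

locate : (f : ℕ → ℕ) → ∀ K j → f 0 < j → j ≤ f K → ∃[ m ] (m < K × f m < j × j ≤ f (suc m))
locate f zero    j f0<j j≤f0 = ⊥-elim (<⇒≱ f0<j j≤f0)
locate f (suc K) j f0<j j≤fK+1 with j ≤? f K
... | yes j≤fK = let m , m<K , rest = locate f K j f0<j j≤fK in m , m<n⇒m<1+n m<K , rest
... | no j≰fK  = K , ≤-refl , ≰⇒> j≰fK , j≤fK+1

exists-up-to-suc : ∀ {ℓ} (P : ℕ → Set ℓ) K →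
  (∃[ k ] (1 ≤ k × k ≤ suc K × P k)) ⇔ (P (suc K) ⊎ ∃[ k ] (1 ≤ k × k ≤ K × P k))
exists-up-to-suc P K = mk⇔ to from
  where
  to : ∃[ k ] (1 ≤ k × k ≤ suc K × P k) → P (suc K) ⊎ ∃[ k ] (1 ≤ k × k ≤ K × P k)
  to (k , 1≤k , k≤K+1 , Pk) with m≤n⇒m<n∨m≡n k≤K+1
  ... | inj₁ k<K+1 = inj₂ (k , 1≤k , ≤-pred k<K+1 , Pk)
  ... | inj₂ refl  = inj₁ Pk
  from : P (suc K) ⊎ ∃[ k ] (1 ≤ k × k ≤ K × P k) → ∃[ k ] (1 ≤ k × k ≤ suc K × P k)
  from (inj₁ PK+1)               = suc K , s≤s z≤n , ≤-refl , PK+1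
  from (inj₂ (k , 1≤k , k≤K , Pk)) = k , 1≤k , m≤n⇒m≤1+n k≤K , Pk

-- The staircase partition for n blocks, assuming every block has a row:
-- kp + 2 ≤ t for k < n (for n = N this is the definition of N).
module Staircase (t p n : ℕ) (room : ∀ k → k < n → k * p + 2 ≤ t) where

  -- height k = a_{k+1}, the number of rows of block k+1.
  height : ℕ → ℕ
  height k = t ∸ k * p ∸ 1

  -- width k = c_k, the row length of block k.
  width : ℕ → ℕ
  width zero    = 0
  width (suc k) = width k + k * p + 1

  depth : ℕ → ℕ
  depth zero    = 0
  depth (suc k) = height k + depth k

  blocks : ℕ → List ℕ
  blocks zero    = []
  blocks (suc k) = stack (height k) (width (suc k)) (blocks k)

  height-room : ∀ k → k < n → height k + (k * p + 1) ≡ t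
  height-room k k<n = trans (cong (_+ (k * p + 1)) (∸-+-assoc t (k * p) 1))
                            (m∸n+n≡m (≤-trans (+-monoʳ-≤ (k * p) (n≤1+n 1)) (room k k<n)))

  width-step : ∀ k → width k ≤ width (suc k)
  width-step k = ≤-trans (m≤m+n (width k) (k * p)) (m≤m+n _ 1)

  width-mono : ∀ {m K} → m ≤ K → width m ≤ width K
  width-mono {K = zero}  z≤n = ≤-refl
  width-mono {K = suc K} m≤K with m≤n⇒m<n∨m≡n m≤K
  ... | inj₁ m<K+1 = ≤-trans (width-mono (≤-pred m<K+1)) (width-step K)
  ... | inj₂ refl  = ≤-refl

  width-pos : ∀ k → 1 ≤ width (suc k)
  width-pos k = m≤n+m 1 (width k + k * p)

  blocks-bounded : ∀ K → All (_≤ width K) (blocks K)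
  blocks-bounded zero    = []
  blocks-bounded (suc k) = ++⁺ (replicate⁺ (height k) ≤-refl)
                               (All.map (λ r≤w → ≤-trans r≤w (width-step k)) (blocks-bounded k))

  below-top : ∀ k → All (_≤ width (suc k)) (blocks k)
  below-top k = All.map (λ r≤w → ≤-trans r≤w (width-step k)) (blocks-bounded k)

  blocks-partition : ∀ K → IsPartition (blocks K)
  blocks-partition zero    = [] , []
  blocks-partition (suc k) = stack-partition (height k) (width (suc k)) (blocks k) (width-pos k)
    (below-top k) (blocks-partition k)

  width+depth : ∀ K → K ≤ n → width K + depth K ≡ K * t
  width+depth zero    _     = refl
  width+depth (suc k) k<n = begin
      width k + k * p + 1 + (height k + depth k)
    ≡⟨ regroup (width k) (k * p) (height k) (depth k) ⟩
      (width k + depth k) + (height k + (k * p + 1))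
    ≡⟨ cong₂ _+_ (width+depth k (≤-trans (n≤1+n k) k<n)) (height-room k k<n) ⟩
      k * t + t
    ≡⟨ +-comm (k * t) t ⟩
      suc k * t
    ∎ where
      open ≡-Reasoning
      regroup : ∀ w kp h d → w + kp + 1 + (h + d) ≡ (w + d) + (h + (kp + 1))
      regroup = solve-∀

  conj-blocks : ∀ K m j → m ≤ K → width m < j → j ≤ width (suc m) → conj (blocks K) j + depth m ≡ depth K
  conj-blocks zero    .zero j z≤n _ _ = refl
  conj-blocks (suc k) m j m≤k+1 w<j j≤w with m≤n⇒m<n∨m≡n m≤k+1
  ... | inj₂ refl = cong (_+ depth (suc k)) (conj-beyond (blocks (suc k)) j
                      (All.map (λ r≤w → ≤-<-trans r≤w w<j) (blocks-bounded (suc k))))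
  ... | inj₁ m<k+1 = begin
      conj (blocks (suc k)) j + depth m
    ≡⟨ cong (_+ depth m) (conj-stack (height k) (width (suc k)) (blocks k) j
          (≤-trans j≤w (width-mono (s≤s (≤-pred m<k+1))))) ⟩
      height k + conj (blocks k) j + depth m
    ≡⟨ +-assoc (height k) (conj (blocks k) j) (depth m) ⟩
      height k + (conj (blocks k) j + depth m)
    ≡⟨ cong (height k +_) (conj-blocks k m j (≤-pred m<k+1) w<j j≤w) ⟩
      depth (suc k)
    ∎ where open ≡-Reasoning

  top-hook-identity : ∀ m e i j → suc (m + e) ≤ n → 1 ≤ i → i ≤ height (m + e) →
    width m < j → j ≤ width (suc m) →
    hook (blocks (suc (m + e))) i j + i + j + depth m ≡ suc (m + e) * t + 1
  top-hook-identity m e i j k<n 1≤i i≤h w<j j≤w = begin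
      hook (blocks (suc k)) i j + i + j + depth m
    ≡⟨ cong (_+ depth m) (hook-stack-top (height k) (width (suc k)) (blocks k) i j 1≤i i≤h
          (≤-trans j≤w (width-mono (s≤s (m≤m+n m e))))) ⟩
      width (suc k) + (height k + conj (blocks k) j) + 1 + depth m
    ≡⟨ regroup (width (suc k)) (height k) (conj (blocks k) j) (depth m) ⟩
      width (suc k) + (height k + (conj (blocks k) j + depth m)) + 1
    ≡⟨ cong (λ d → width (suc k) + (height k + d) + 1) (conj-blocks k m j (m≤m+n m e) w<j j≤w) ⟩
      width (suc k) + depth (suc k) + 1
    ≡⟨ cong (_+ 1) (width+depth (suc k) k<n) ⟩
      suc k * t + 1
    ∎ where
      open ≡-Reasoning
      k = m + e
      regroup : ∀ w h c d → w + (h + c) + 1 + d ≡ w + (h + (c + d)) + 1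
      regroup = solve-∀

  top-hook-window : ∀ m e i j → suc (m + e) ≤ n → 1 ≤ i → i ≤ height (m + e) →
    width m < j → j ≤ width (suc m) → S t p (suc e) (hook (blocks (suc (m + e))) i j)
  top-hook-window m e i j k<n 1≤i i≤h w<j j≤w =
    +-cancelʳ-≤ X (e * (t + p) + 1) H lower , <⇒≤∸1 (+-cancelʳ-≤ (m * t + 1) (suc H) (suc e * t) upper)
    where
    open ≤-Reasoning
    H  = hook (blocks (suc (m + e))) i j
    Hk = height (m + e)
    W  = width m
    D  = depth m
    X  = Hk + (W + m * p + 1) + D
    identity : H + i + j + D ≡ suc (m + e) * t + 1
    identity = top-hook-identity m e i j k<n 1≤i i≤h w<j j≤w
    lower : e * (t + p) + 1 + X ≤ H + X
    lower = begin
        e * (t + p) + 1 + X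
      ≡⟨ regroup₁ e t p m Hk W D ⟩
        (W + D) + e * t + (Hk + ((m + e) * p + 1)) + 1
      ≡⟨ cong₂ (λ wd hk → wd + e * t + hk + 1) (width+depth m (≤-trans (m≤m+n m e) (<⇒≤ k<n)))
                                                 (height-room (m + e) k<n) ⟩
        m * t + e * t + t + 1
      ≡⟨ regroup₂ m e t ⟩
        suc (m + e) * t + 1
      ≡⟨ identity ⟨
        H + i + j + D
      ≤⟨ +-monoˡ-≤ D (+-mono-≤ (+-monoʳ-≤ H i≤h) j≤w) ⟩
        H + Hk + (W + m * p + 1) + D
      ≡⟨ regroup₃ H Hk (W + m * p + 1) D ⟩
        H + X
      ∎
      where
      regroup₁ : ∀ e t p m h w d →
        e * (t + p) + 1 + (h + (w + m * p + 1) + d) ≡ (w + d) + e * t + (h + ((m + e) * p + 1)) + 1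
      regroup₁ = solve-∀
      regroup₂ : ∀ m e t → m * t + e * t + t + 1 ≡ suc (m + e) * t + 1
      regroup₂ = solve-∀
      regroup₃ : ∀ x h c d → x + h + c + d ≡ x + (h + c + d)
      regroup₃ = solve-∀
    upper : suc H + (m * t + 1) ≤ suc e * t + (m * t + 1)
    upper = begin
        suc H + (m * t + 1)
      ≡⟨ cong (λ mt → suc H + (mt + 1)) (width+depth m (≤-trans (m≤m+n m e) (<⇒≤ k<n))) ⟨
        suc H + (W + D + 1)
      ≡⟨ regroup₁ H W D ⟩
        H + 1 + suc W + D
      ≤⟨ +-monoˡ-≤ D (+-mono-≤ (+-monoʳ-≤ H 1≤i) w<j) ⟩
        H + i + j + D
      ≡⟨ identity ⟩
        suc (m + e) * t + 1
      ≡⟨ regroup₂ m e t ⟩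
        suc e * t + (m * t + 1)
      ∎
      where
      regroup₁ : ∀ x w d → suc x + (w + d + 1) ≡ x + 1 + suc w + d
      regroup₁ = solve-∀
      regroup₂ : ∀ m e t → suc (m + e) * t + 1 ≡ suc e * t + (m * t + 1)
      regroup₂ = solve-∀

  hooks-in-windows : ∀ K → K ≤ n → ∀ i j → Box (blocks K) i j → ∃[ e ] S t p (suc e) (hook (blocks K) i j)
  hooks-in-windows zero    _   i j (1≤i , i≤0 , _) = ⊥-elim (<⇒≱ 1≤i i≤0)
  hooks-in-windows (suc k) k<n i j box@(1≤i , _ , 1≤j , _)
    with box-split (height k) (width (suc k)) (blocks k) i j (below-top k) box
  ... | inj₂ (o , box′ , same-hook) =
    let e , window = hooks-in-windows k (≤-trans (n≤1+n k) k<n) (suc o) j box′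
    in e , subst (S t p (suc e)) (sym same-hook) window
  ... | inj₁ (i≤h , j≤w) with locate width (suc k) j 1≤j j≤w
  ...   | m , m<k+1 , w<j , j≤w′ with m≤n⇒∃[o]m+o≡n (≤-pred m<k+1)
  ...     | e , refl = e , top-hook-window m e i j k<n 1≤i i≤h w<j j≤w′

  first-column-hook : ∀ k i → suc k ≤ n → 1 ≤ i → i ≤ height k → hook (blocks (suc k)) i 1 + i ≡ suc k * t
  first-column-hook k i k<n 1≤i i≤h =
    +-cancelʳ-≡ 1 _ _ (trans (sym (+-identityʳ _)) (top-hook-identity 0 k i 1 k<n 1≤i i≤h (s≤s z≤n) ≤-refl))

  first-column-window : ∀ k x → suc k ≤ n →
    (∃[ i ] (1 ≤ i × i ≤ height k × hook (blocks (suc k)) i 1 ≡ x)) ⇔ S t p (suc k) x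
  first-column-window k x k<n = ⇔.trans (mk⇔ to from) (⇔.sym (S-offsets t p k (height k) x T≡))
    where
    T≡ : suc k * t ≡ height k + (k * (t + p) + 1)
    T≡ = begin
        t + k * t                        ≡⟨ cong (_+ k * t) (height-room k k<n) ⟨
        height k + (k * p + 1) + k * t   ≡⟨ regroup (height k) k t p ⟩
        height k + (k * (t + p) + 1)     ∎
      where
      open ≡-Reasoning
      regroup : ∀ h k t p → h + (k * p + 1) + k * t ≡ h + (k * (t + p) + 1)
      regroup = solve-∀
    to : ∃[ i ] (1 ≤ i × i ≤ height k × hook (blocks (suc k)) i 1 ≡ x) →
         ∃[ i ] (1 ≤ i × i ≤ height k × x + i ≡ suc k * t)
    to (i , 1≤i , i≤h , h≡x) = i , 1≤i , i≤h , trans (cong (_+ i) (sym h≡x)) (first-column-hook k i k<n 1≤i i≤h)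
    from : ∃[ i ] (1 ≤ i × i ≤ height k × x + i ≡ suc k * t) →
           ∃[ i ] (1 ≤ i × i ≤ height k × hook (blocks (suc k)) i 1 ≡ x)
    from (i , 1≤i , i≤h , x+i≡T) =
      i , 1≤i , i≤h , +-cancelʳ-≡ i _ _ (trans (first-column-hook k i k<n 1≤i i≤h) (sym x+i≡T))

  blocks-beta : ∀ K → K ≤ n → ∀ x → (∃[ k ] (1 ≤ k × k ≤ K × S t p k x)) ⇔ InBeta (blocks K) x
  blocks-beta zero    _   x = mk⇔ (λ { (k , 1≤k , k≤0 , _) → ⊥-elim (<⇒≱ 1≤k k≤0) })
                                  (λ { (i , 1≤i , i≤0 , _) → ⊥-elim (<⇒≱ 1≤i i≤0) })
  blocks-beta (suc k) k<n x =
    ⇔.trans (exists-up-to-suc (λ k → S t p k x) k)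
   (⇔.trans (⇔.sym (first-column-window k x k<n) ⊎-⇔ blocks-beta k (≤-trans (n≤1+n k) k<n) x)
            (⇔.sym (beta-stack (height k) (width (suc k)) (blocks k) x (width-pos k) (below-top k))))

lemma3p1 : (t p : ℕ) → .{{_ : NonZero p}} → 1 ≤ t → 1 ≤ N t p →
    (∀ k → 1 ≤ k → k ≤ N t p → a t p k ≡ t ∸ (k ∸ 1) * p ∸ 1)
    × (1 ≤ a t p (N t p) × a t p (N t p) ≤ p)
    × (∀ k → 1 ≤ k → k ≤ N t p ∸ 1 → a t p k ≡ a t p (k + 1) + p)
    × (∀ k x i → 1 ≤ k → k ≤ N t p ∸ 1 → S t p (k + 1) x → i ≤ p →
    t + i ≤ x × S t p k (x ∸ (t + i)))
    × (∃[ λs ] (IsPartition λs × IsMultiCore t p λs ×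
    (∀ x → (∃[ k ] (1 ≤ k × k ≤ N t p × S t p k x)) ⇔ InBeta λs x)))
lemma3p1 t p 1≤t 1≤N =
  (λ { (suc k) _ _ → a-closed t p k }) ,
  a-top t p (N t p) 1≤N room (N-max t p 1≤t) ,
  (λ { (suc k) _ k≤N-1 → a-step t p k (untruncated (suc k) (≤∸1⇒< (s≤s z≤n) k≤N-1)) }) ,
  (λ k x i 1≤k _ → S-shift t p k x i 1≤k) ,
  (blocks (N t p) , blocks-partition (N t p) , core , blocks-beta (N t p) ≤-refl)
  where
  room : ∀ k → k < N t p → k * p + 2 ≤ t
  room = N-room t p 1≤t
  -- below N, a_{k+1} = t − kp − 1 is computed without truncation
  untruncated : ∀ k → k < N t p → k * p + 1 ≤ t
  untruncated k k<N = ≤-trans (+-monoʳ-≤ (k * p) (n≤1+n 1)) (room k k<N)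
  open Staircase t p (N t p) room
  -- Every hook lies in a window S_{e+1}, and no s ∈ [t, t+p] divides such a number.
  core : IsMultiCore t p (blocks (N t p))
  core s t≤s s≤t+p i j box =
    let e , window = hooks-in-windows (N t p) ≤-refl i j box
    in S-no-divisor t p e (hook (blocks (N t p)) i j) s window t≤s s≤t+p
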